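{- (Truth Lemma) For every $\pi\in\mathsf{PP}$ and every $\sigma\in\mathsf{SD}$: (1) in the canonical model, $[\![\pi]\!]_P:Z^S\to\mathbf{A}$ and $(\![\pi]\!)_P:\mathbf{A}\times Z^S\to\mathbf{A}$ are given by $z\mapsto f_z(\pi)$ and $(\alpha,z)\mapsto u_z(\pi)\to\alpha$; (2) $[\![\sigma]\!]_S:Z^P\to\mathbf{A}$ and $(\![\sigma]\!)_S:\mathbf{A}\times Z^P\to\mathbf{A}$ are given by $z\mapsto g_z(\sigma)$ and $(\alpha,z)\mapsto v_z(\sigma)\to\alpha$.
   Context: $\mathbf{A}$ is a complete, frame-distributive and dually frame-distributive commutative residuated lattice. $(\mathbf{SD},\mathbf{PP},\lozenge,\Diamond)$ is the Lindenbaum–Tarski heterogeneous algebra of the basic multi-type normal logic, formulas identified with their classes. Proper $\mathbf{A}$-filters $f$ ($\top\mapsto1$, $\bot\mapsto0$, $\wedge$-preserving) and complements of proper $\mathbf{A}$-ideals $u$ ($\bot\mapsto0$, $\top\mapsto1$, $\vee$-preserving). Canonical frame: $Z^S$ = pairs $(f_z,u_z)$ on $\mathbf{PP}$ with $\bigwedge_\pi(f_z(\pi)\to u_z(\pi))=1$; $Z^P$ = pairs $(g_z,v_z)$ on $\mathbf{SD}$ with $\bigwedge_\sigma(g_z(\sigma)\to v_z(\sigma))=1$; $E_S(z,z')=\bigwedge_\pi(f_z(\pi)\to u_{z'}(\pi))$, $E_P(z,z')=\bigwedge_\sigma(g_z(\sigma)\to v_{z'}(\sigma))$, $R_\Diamond(z,z')=\bigwedge_\pi(f_{z'}(\pi)\to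 v_z(\Diamond\pi))$ ($z\in Z^P,z'\in Z^S$), $R_\lozenge(z,z')=\bigwedge_\sigma(g_{z'}(\sigma)\to u_z(\lozenge\sigma))$ ($z\in Z^S,z'\in Z^P$). For a graph $(Z,E)$: $f^{[1]}(\alpha,z)=\bigwedge_{z'}[f(z')\to(E(z',z)\to\alpha)]$ for $f:Z\to\mathbf{A}$ and $u^{[0]}(z)=\bigwedge_{(\alpha,z')}[u(\alpha,z')\to(E(z,z')\to\alpha)]$ for $u:\mathbf{A}\times Z\to\mathbf{A}$. Canonical model: atoms evaluated by $[\![p]\!]_P(z)=f_z(p)$, $(\![p]\!)_P(\alpha,z)=u_z(p)\to\alpha$, $[\![p]\!]_S(z)=g_z(p)$, $(\![p]\!)_S(\alpha,z)=v_z(p)\to\alpha$; extended to all formulas by: $[\![\top]\!]$ constantly $1$ and $(\![\top]\!)=[\![\top]\!]^{[1]}$; $(\![\bot]\!)$ constantly $1$ and $[\![\bot]\!]=(\![\bot]\!)^{[0]}$; $[\![\phi\wedge\psi]\!]=[\![\phi]\!]\wedge[\![\psi]\!]$, $(\![\phi\wedge\psi]\!)=[\![\phi\wedge\psi]\!]^{[1]}$; $(\![\phi\vee\psi]\!)=(\![\phi]\!)\wedge(\![\psi]\!)$, $[\![\phi\vee\psi]\!]=(\![\phi\vee\psi]\!)^{[0]}$; $(\![\Diamond\pi]\!)_S(\alpha,z)=\bigwedge_{z'\in Z^S}[[\![\pi]\!]_P(z')\to(R_\Diamond(z,z')\to\alpha)]$ and $[\![\Diamond\pi]\!]_S=(\![\Diamond\pi]\!)_S^{[0]}$;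 $(\![\lozenge\sigma]\!)_P(\alpha,z)=\bigwedge_{z'\in Z^P}[[\![\sigma]\!]_S(z')\to(R_\lozenge(z,z')\to\alpha)]$ and $[\![\lozenge\sigma]\!]_P=(\![\lozenge\sigma]\!)_P^{[0]}$ (operations $[0],[1]$ w.r.t.\ $E_S$ on $Z^S$ and $E_P$ on $Z^P$). -}

module Defs where

open import Data.Product using (_×_; _,_; proj₁; proj₂)
open import Relation.Binary.PropositionalEquality using (_≡_)
open import Algebra.Lattice.Structures using (IsLattice)
open import Algebra.Structures using (IsCommutativeMonoid)

record CRL : Set₁ where
  infixr 7 _∧_
  infixr 6 _∨_
  infixr 8 _⊗_
  infixr 5 _⇒_
  field
    Carrier : Set
    _∧_ _∨_ _⊗_ _⇒_ : Carrier → Carrier → Carrier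
    𝟘 𝟙 : Carrier
    ⋀ ⋁ : {I : Set} → (I → Carrier) → Carrier
    isLattice : IsLattice _≡_ _∨_ _∧_
    ⊗-isCommutativeMonoid : IsCommutativeMonoid _≡_ _⊗_ 𝟙
    -- order: a ≤ b  iff  a ∧ b ≡ a
    𝟘-least : ∀ a → 𝟘 ∧ a ≡ 𝟘
    𝟙-greatest : ∀ a → a ∧ 𝟙 ≡ a
    residuated : ∀ a b c → ((a ⊗ b) ∧ c ≡ a ⊗ b → a ∧ (b ⇒ c) ≡ a)
                         × (a ∧ (b ⇒ c) ≡ a → (a ⊗ b) ∧ c ≡ a ⊗ b)
    ⋀-lower : ∀ {I : Set} (h : I → Carrier) (i : I) → ⋀ h ∧ h i ≡ ⋀ h
    ⋀-greatest : ∀ {I : Set} (h : I → Carrier) (a : Carrier) →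
                 (∀ i → a ∧ h i ≡ a) → a ∧ ⋀ h ≡ a
    ⋁-upper : ∀ {I : Set} (h : I → Carrier) (i : I) → h i ∧ ⋁ h ≡ h i
    ⋁-least : ∀ {I : Set} (h : I → Carrier) (a : Carrier) →
              (∀ i → h i ∧ a ≡ h i) → ⋁ h ∧ a ≡ ⋁ h
    frameDistributive : ∀ {I : Set} (a : Carrier) (h : I → Carrier) →
                        a ∧ ⋁ h ≡ ⋁ (λ i → a ∧ h i)
    dualFrameDistributive : ∀ {I : Set} (a : Carrier) (h : I → Carrier) →
                            a ∨ ⋀ h ≡ ⋀ (λ i → a ∨ h i)

module Syntax (AtP AtS : Set) where

  infixr 7 _∧P_ _∧S_
  infixr 6 _∨P_ _∨S_

  mutual
    data PP : Set where
      atP : AtP → PP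
      ⊤P ⊥P : PP
      _∧P_ _∨P_ : PP → PP → PP
      loz : SD → PP
    data SD : Set where
      atS : AtS → SD
      ⊤S ⊥S : SD
      _∧S_ _∨S_ : SD → SD → SD
      dia : PP → SD

  infix 4 _⊢P_ _⊢S_
  mutual
    data _⊢P_ : PP → PP → Set where
      idP : ∀ {φ} → φ ⊢P φ
      cutP : ∀ {φ ψ χ} → φ ⊢P ψ → ψ ⊢P χ → φ ⊢P χ
      ⊥P-l : ∀ {φ} → ⊥P ⊢P φ
      ⊤P-r : ∀ {φ} → φ ⊢P ⊤P
      ∧P-l₁ : ∀ {φ ψ} → φ ∧P ψ ⊢P φ
      ∧P-l₂ : ∀ {φ ψ} → φ ∧P ψ ⊢P ψ
      ∧P-r : ∀ {φ ψ χ} → φ ⊢P ψ → φ ⊢P χ → φ ⊢P ψ ∧P χ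
      ∨P-r₁ : ∀ {φ ψ} → φ ⊢P φ ∨P ψ
      ∨P-r₂ : ∀ {φ ψ} → ψ ⊢P φ ∨P ψ
      ∨P-l : ∀ {φ ψ χ} → φ ⊢P χ → ψ ⊢P χ → φ ∨P ψ ⊢P χ
      loz-mono : ∀ {σ τ} → σ ⊢S τ → loz σ ⊢P loz τ
      loz-⊥ : loz ⊥S ⊢P ⊥P
      loz-∨ : ∀ {σ τ} → loz (σ ∨S τ) ⊢P loz σ ∨P loz τ
    data _⊢S_ : SD → SD → Set where
      idS : ∀ {φ} → φ ⊢S φ
      cutS : ∀ {φ ψ χ} → φ ⊢S ψ → ψ ⊢S χ → φ ⊢S χ
      ⊥S-l : ∀ {φ} → ⊥S ⊢S φ
      ⊤S-r : ∀ {φ} → φ ⊢S ⊤S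
      ∧S-l₁ : ∀ {φ ψ} → φ ∧S ψ ⊢S φ
      ∧S-l₂ : ∀ {φ ψ} → φ ∧S ψ ⊢S ψ
      ∧S-r : ∀ {φ ψ χ} → φ ⊢S ψ → φ ⊢S χ → φ ⊢S ψ ∧S χ
      ∨S-r₁ : ∀ {φ ψ} → φ ⊢S φ ∨S ψ
      ∨S-r₂ : ∀ {φ ψ} → ψ ⊢S φ ∨S ψ
      ∨S-l : ∀ {φ ψ χ} → φ ⊢S χ → ψ ⊢S χ → φ ∨S ψ ⊢S χ
      dia-mono : ∀ {π ρ} → π ⊢P ρ → dia π ⊢S dia ρ
      dia-⊥ : dia ⊥P ⊢S ⊥S
      dia-∨ : ∀ {π ρ} → dia (π ∨P ρ) ⊢S dia π ∨S dia ρ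

module Canonical (A : CRL) (AtP AtS : Set) where
  open CRL A
  open Syntax AtP AtS

  -- Z^S : pairs (f, u) on the Lindenbaum–Tarski algebra PP
  -- (maps on formulas that are invariant under interderivability,
  --  i.e. maps on equivalence classes)
  record ZS : Set where
    field
      f u : PP → Carrier
      f-wd : ∀ {φ ψ} → φ ⊢P ψ → ψ ⊢P φ → f φ ≡ f ψ
      f-⊤ : f ⊤P ≡ 𝟙
      f-⊥ : f ⊥P ≡ 𝟘
      f-∧ : ∀ φ ψ → f (φ ∧P ψ) ≡ f φ ∧ f ψ
      u-wd : ∀ {φ ψ} → φ ⊢P ψ → ψ ⊢P φ → u φ ≡ u ψ
      u-⊥ : u ⊥P ≡ 𝟘
      u-⊤ : u ⊤P ≡ 𝟙
      u-∨ : ∀ φ ψ → u (φ ∨P ψ) ≡ u φ ∨ u ψ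
      fu-compat : ⋀ (λ π → f π ⇒ u π) ≡ 𝟙

  record ZP : Set where
    field
      g v : SD → Carrier
      g-wd : ∀ {φ ψ} → φ ⊢S ψ → ψ ⊢S φ → g φ ≡ g ψ
      g-⊤ : g ⊤S ≡ 𝟙
      g-⊥ : g ⊥S ≡ 𝟘
      g-∧ : ∀ φ ψ → g (φ ∧S ψ) ≡ g φ ∧ g ψ
      v-wd : ∀ {φ ψ} → φ ⊢S ψ → ψ ⊢S φ → v φ ≡ v ψ
      v-⊥ : v ⊥S ≡ 𝟘
      v-⊤ : v ⊤S ≡ 𝟙
      v-∨ : ∀ φ ψ → v (φ ∨S ψ) ≡ v φ ∨ v ψ
      gv-compat : ⋀ (λ σ → g σ ⇒ v σ) ≡ 𝟙

  open ZS
  open ZP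

  E-S : ZS → ZS → Carrier
  E-S z z' = ⋀ (λ π → f z π ⇒ u z' π)

  E-P : ZP → ZP → Carrier
  E-P z z' = ⋀ (λ σ → g z σ ⇒ v z' σ)

  R-dia : ZP → ZS → Carrier
  R-dia z z' = ⋀ (λ π → f z' π ⇒ v z (dia π))

  R-loz : ZS → ZP → Carrier
  R-loz z z' = ⋀ (λ σ → g z' σ ⇒ u z (loz σ))

  up1 : {Z : Set} → (Z → Z → Carrier) → (Z → Carrier) → Carrier → Z → Carrier
  up1 E h α z = ⋀ (λ z' → h z' ⇒ (E z' z ⇒ α))

  dn0 : {Z : Set} → (Z → Z → Carrier) → (Carrier → Z → Carrier) → Z → Carrier
  dn0 E k z = ⋀ (λ (p : Carrier × _) → k (proj₁ p) (proj₂ p) ⇒ (E z (proj₂ p) ⇒ proj₁ p))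

  diaDesc : (ZS → Carrier) → Carrier → ZP → Carrier
  diaDesc ext α z = ⋀ (λ z' → ext z' ⇒ (R-dia z z' ⇒ α))

  lozDesc : (ZP → Carrier) → Carrier → ZS → Carrier
  lozDesc ext α z = ⋀ (λ z' → ext z' ⇒ (R-loz z z' ⇒ α))

  -- canonical model: extension ⟦_⟧ and description ⦅_⦆.
  -- Each clause is the paper's clause with the equation defining one side
  -- via the other unfolded (so that recursion is structural).
  mutual
    ⟦_⟧P : PP → ZS → Carrier
    ⟦ atP p ⟧P z = f z (atP p)
    ⟦ ⊤P ⟧P z = 𝟙
    ⟦ ⊥P ⟧P = dn0 E-S (λ α z → 𝟙)
    ⟦ φ ∧P ψ ⟧P z = ⟦ φ ⟧P z ∧ ⟦ ψ ⟧P z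
    ⟦ φ ∨P ψ ⟧P = dn0 E-S (λ α z → ⦅ φ ⦆P α z ∧ ⦅ ψ ⦆P α z)
    ⟦ loz σ ⟧P = dn0 E-S (lozDesc ⟦ σ ⟧S)

    ⦅_⦆P : PP → Carrier → ZS → Carrier
    ⦅ atP p ⦆P α z = u z (atP p) ⇒ α
    ⦅ ⊤P ⦆P = up1 E-S (λ z → 𝟙)
    ⦅ ⊥P ⦆P α z = 𝟙
    ⦅ φ ∧P ψ ⦆P = up1 E-S (λ z → ⟦ φ ⟧P z ∧ ⟦ ψ ⟧P z)
    ⦅ φ ∨P ψ ⦆P α z = ⦅ φ ⦆P α z ∧ ⦅ ψ ⦆P α z
    ⦅ loz σ ⦆P = lozDesc ⟦ σ ⟧S

    ⟦_⟧S : SD → ZP → Carrier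
    ⟦ atS p ⟧S z = g z (atS p)
    ⟦ ⊤S ⟧S z = 𝟙
    ⟦ ⊥S ⟧S = dn0 E-P (λ α z → 𝟙)
    ⟦ φ ∧S ψ ⟧S z = ⟦ φ ⟧S z ∧ ⟦ ψ ⟧S z
    ⟦ φ ∨S ψ ⟧S = dn0 E-P (λ α z → ⦅ φ ⦆S α z ∧ ⦅ ψ ⦆S α z)
    ⟦ dia π ⟧S = dn0 E-P (diaDesc ⟦ π ⟧P)

    ⦅_⦆S : SD → Carrier → ZP → Carrier
    ⦅ atS p ⦆S α z = v z (atS p) ⇒ α
    ⦅ ⊤S ⦆S = up1 E-P (λ z → 𝟙)
    ⦅ ⊥S ⦆S α z = 𝟙
    ⦅ φ ∧S ψ ⦆S = up1 E-P (λ z → ⟦ φ ⟧S z ∧ ⟦ ψ ⟧S z)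
    ⦅ φ ∨S ψ ⦆S α z = ⦅ φ ⦆S α z ∧ ⦅ ψ ⦆S α z
    ⦅ dia π ⦆S = diaDesc ⟦ π ⟧P

module Submission where

-- Both types of formulas, PP and SD, form a sequent calculus for bounded
-- lattices in which inconsistency (φ ⊢ ⊥) is decidable; decidability comes
-- from soundness and refutation-completeness for the one-world model.  Over
-- such a calculus a point is a pair (f, u) of an A-filter and the complement
-- of an A-ideal with f ≤ u.  Two families of points drive the whole argument:
-- the principal point of a consistent formula, and a point z with u replaced
-- by the (graded) complement of the ideal generated by a formula χ.
-- From these, two general facts follow for every point space:
--   * (·)^[0] of the map (α, z) ↦ u z χ ⇒ α is z ↦ f z χ   (lower-truth);
--   * over the relation built from a normal monotone modality m, the
--     description of m σ computed from z ↦ f z σ is (α, z) ↦ u z (m σ) ⇒ α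
--     (description-truth); (·)^[1] is the case m = identity.

open import Defs
open import Data.Product using (_×_; _,_; proj₁; proj₂)
open import Relation.Binary.PropositionalEquality using (_≡_; refl; sym; trans; cong; cong₂)
open import Relation.Nullary using (¬_; Dec; yes; no)
open import Relation.Nullary.Decidable using (T?)
open import Data.Bool using (Bool; true; false; T) renaming (_∧_ to _∧ᵇ_; _∨_ to _∨ᵇ_)
open import Data.Bool.Properties using (T-∧; T-∨)
open import Data.Sum using (inj₁; inj₂; [_,_])
open import Data.Empty using (⊥-elim)
open import Function.Bundles using (Equivalence)
open import Algebra.Lattice.Bundles using (Lattice)
open import Algebra.Structures using (IsCommutativeMonoid)
import Algebra.Lattice.Properties.Lattice as LatticeProperties
open import Relation.Binary.Bundles using (Poset)
open import Relation.Binary.Lattice using (IsLattice)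
import Relation.Binary.Reasoning.PartialOrder as ≤-Reasoning

module ResiduatedLattice (A : CRL) where
  open CRL A

  -- A as a lattice, ordered by a ≤ b ⇔ a ≡ a ∧ b (the library's natural order)
  lattice : Lattice _ _
  lattice = record { Carrier = Carrier ; _≈_ = _≡_ ; _∨_ = _∨_ ; _∧_ = _∧_ ; isLattice = isLattice }

  open Lattice lattice using (∨-comm)
  open LatticeProperties lattice public using (∨-idem)
  open LatticeProperties lattice using (poset; ∨-∧-isOrderTheoreticLattice)
  open Poset poset public
    using (_≤_)
    renaming (refl to ≤-refl; trans to ≤-trans; antisym to ≤-antisym; reflexive to ≤-reflexive)
  open IsLattice ∨-∧-isOrderTheoreticLattice public
    using (x∧y≤x; x∧y≤y; ∧-greatest; x≤x∨y; y≤x∨y; ∨-least)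
  open ≤-Reasoning poset public
  open IsCommutativeMonoid ⊗-isCommutativeMonoid
    using () renaming (comm to ⊗-comm; assoc to ⊗-assoc; identityˡ to ⊗-identityˡ; identityʳ to ⊗-identityʳ)

  𝟘-min : ∀ {a} → 𝟘 ≤ a
  𝟘-min {a} = sym (𝟘-least a)

  𝟙-max : ∀ {a} → a ≤ 𝟙
  𝟙-max {a} = sym (𝟙-greatest a)

  ⋀-lb : ∀ {I : Set} {h : I → Carrier} (i : I) → ⋀ h ≤ h i
  ⋀-lb {h = h} i = sym (⋀-lower h i)

  ⋀-glb : ∀ {I : Set} {h : I → Carrier} {a} → (∀ i → a ≤ h i) → a ≤ ⋀ h
  ⋀-glb {h = h} {a} p = sym (⋀-greatest h a (λ i → sym (p i)))

  ⋁-ub : ∀ {I : Set} {h : I → Carrier} (i : I) → h i ≤ ⋁ h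
  ⋁-ub {h = h} i = sym (⋁-upper h i)

  ⋁-lub : ∀ {I : Set} {h : I → Carrier} {a} → (∀ i → h i ≤ a) → ⋁ h ≤ a
  ⋁-lub {h = h} {a} p = sym (⋁-least h a (λ i → sym (p i)))

  ⇒-intro : ∀ {a b c} → a ⊗ b ≤ c → a ≤ b ⇒ c
  ⇒-intro {a} {b} {c} p = sym (proj₁ (residuated a b c) (sym p))

  ⇒-elim : ∀ {a b c} → a ≤ b ⇒ c → a ⊗ b ≤ c
  ⇒-elim {a} {b} {c} p = sym (proj₂ (residuated a b c) (sym p))

  modus-ponens : ∀ {a b} → (a ⇒ b) ⊗ a ≤ b
  modus-ponens = ⇒-elim ≤-refl

  ⊗-monoˡ : ∀ {a b c} → a ≤ b → a ⊗ c ≤ b ⊗ c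
  ⊗-monoˡ p = ⇒-elim (≤-trans p (⇒-intro ≤-refl))

  ⊗-monoʳ : ∀ {a b c} → a ≤ b → c ⊗ a ≤ c ⊗ b
  ⊗-monoʳ {a} {b} {c} p = begin
    c ⊗ a ≡⟨ ⊗-comm c a ⟩
    a ⊗ c ≤⟨ ⊗-monoˡ p ⟩
    b ⊗ c ≡⟨ ⊗-comm b c ⟩
    c ⊗ b ∎

  ⇒-exchange : ∀ {a b c} → a ≤ b ⇒ c → b ≤ a ⇒ c
  ⇒-exchange {a} {b} {c} p = ⇒-intro (begin
    b ⊗ a ≡⟨ ⊗-comm b a ⟩
    a ⊗ b ≤⟨ ⇒-elim p ⟩
    c ∎)

  ⇒-antitone : ∀ {a b c} → a ≤ b → b ⇒ c ≤ a ⇒ c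
  ⇒-antitone p = ⇒-intro (≤-trans (⊗-monoʳ p) modus-ponens)

  ⇒-discharge : ∀ {e a} → 𝟙 ≤ e → e ⇒ a ≤ a
  ⇒-discharge {e} {a} p = begin
    e ⇒ a       ≡⟨ ⊗-identityʳ (e ⇒ a) ⟨
    (e ⇒ a) ⊗ 𝟙 ≤⟨ ⊗-monoʳ p ⟩
    (e ⇒ a) ⊗ e ≤⟨ modus-ponens ⟩
    a ∎

  ≤⇒𝟙 : ∀ {a b} → a ≤ b → 𝟙 ≤ a ⇒ b
  ≤⇒𝟙 {a} {b} p = ⇒-intro (≤-trans (≤-reflexive (⊗-identityˡ a)) p)

  𝟘⇒ : ∀ {a} → 𝟘 ⇒ a ≡ 𝟙
  𝟘⇒ = ≤-antisym 𝟙-max (≤⇒𝟙 𝟘-min)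

  ⇒-chain : ∀ {e a b α} → e ≤ a ⇒ b → b ⇒ α ≤ a ⇒ (e ⇒ α)
  ⇒-chain {e} {a} {b} {α} p = ⇒-intro (⇒-intro (begin
    ((b ⇒ α) ⊗ a) ⊗ e ≡⟨ ⊗-assoc (b ⇒ α) a e ⟩
    (b ⇒ α) ⊗ (a ⊗ e) ≤⟨ ⊗-monoʳ (⇒-elim (⇒-exchange p)) ⟩
    (b ⇒ α) ⊗ b       ≤⟨ modus-ponens ⟩
    α ∎))

  ⇒-∨ : ∀ a b c → (a ⇒ c) ∧ (b ⇒ c) ≡ (a ∨ b) ⇒ c
  ⇒-∨ a b c = ≤-antisym
    (⇒-exchange (∨-least (⇒-exchange (x∧y≤x _ _)) (⇒-exchange (x∧y≤y _ _))))
    (∧-greatest (⇒-antitone (x≤x∨y a b)) (⇒-antitone (y≤x∨y a b)))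

  𝟙≤⇒ : ∀ {a b} → 𝟙 ≤ a ⇒ b → a ≤ b
  𝟙≤⇒ {a} {b} p = ≤-trans (≤-reflexive (sym (⊗-identityˡ a))) (⇒-elim p)

  𝟙≤⋀⇒ : ∀ {I : Set} {a b : I → Carrier} → (∀ i → a i ≤ b i) → 𝟙 ≤ ⋀ (λ i → a i ⇒ b i)
  𝟙≤⋀⇒ p = ⋀-glb (λ i → ≤⇒𝟙 (p i))

  ⋀⇒-≡𝟙 : ∀ {I : Set} {a b : I → Carrier} → (∀ i → a i ≤ b i) → ⋀ (λ i → a i ⇒ b i) ≡ 𝟙
  ⋀⇒-≡𝟙 p = ≤-antisym 𝟙-max (𝟙≤⋀⇒ p)

  𝟘-identityˡ : ∀ a → 𝟘 ∨ a ≡ a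
  𝟘-identityˡ a = ≤-antisym (∨-least 𝟘-min ≤-refl) (y≤x∨y 𝟘 a)

  𝟘-identityʳ : ∀ a → a ∨ 𝟘 ≡ a
  𝟘-identityʳ a = ≤-antisym (∨-least ≤-refl 𝟘-min) (x≤x∨y a 𝟘)

  ‖_‖ : Set → Carrier
  ‖ P ‖ = ⋁ (λ (_ : P) → 𝟙)

  ‖‖-intro : ∀ {P : Set} → P → 𝟙 ≤ ‖ P ‖
  ‖‖-intro p = ⋁-ub p

  ‖‖-elim : ∀ {P : Set} {a} → (P → 𝟙 ≤ a) → ‖ P ‖ ≤ a
  ‖‖-elim = ⋁-lub

  ‖‖-mono : ∀ {P Q : Set} → (P → Q) → ‖ P ‖ ≤ ‖ Q ‖
  ‖‖-mono f = ‖‖-elim (λ p → ‖‖-intro (f p))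

  ‖‖-cong : ∀ {P Q : Set} → (P → Q) → (Q → P) → ‖ P ‖ ≡ ‖ Q ‖
  ‖‖-cong f g = ≤-antisym (‖‖-mono f) (‖‖-mono g)

  ‖‖-empty : ∀ {P : Set} → ¬ P → ‖ P ‖ ≡ 𝟘
  ‖‖-empty ¬p = ≤-antisym (‖‖-elim (λ p → ⊥-elim (¬p p))) 𝟘-min

  ‖‖-× : ∀ {P Q : Set} → ‖ P × Q ‖ ≡ ‖ P ‖ ∧ ‖ Q ‖
  ‖‖-× {P} {Q} = ≤-antisym
    (∧-greatest (‖‖-mono proj₁) (‖‖-mono proj₂))
    (begin
      ‖ P ‖ ∧ ‖ Q ‖              ≡⟨ frameDistributive ‖ P ‖ _ ⟩
      ⋁ (λ (_ : Q) → ‖ P ‖ ∧ 𝟙) ≤⟨ ⋁-lub (λ q → ≤-trans (x∧y≤x _ _) (‖‖-mono (_, q))) ⟩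
      ‖ P × Q ‖ ∎)

  ⋀[_]_ : Set → Carrier → Carrier
  ⋀[ P ] b = ⋀ (λ (_ : P) → b)

  ⋀[]-antitone : ∀ {P Q : Set} {b} → (P → Q) → ⋀[ Q ] b ≤ ⋀[ P ] b
  ⋀[]-antitone f = ⋀-glb (λ p → ⋀-lb (f p))

  ⋀[]-cong : ∀ {P Q : Set} {b} → (P → Q) → (Q → P) → ⋀[ P ] b ≡ ⋀[ Q ] b
  ⋀[]-cong f g = ≤-antisym (⋀[]-antitone g) (⋀[]-antitone f)

  ⋀[]-× : ∀ {P Q : Set} {b} → ⋀[ P × Q ] b ≡ ⋀[ P ] b ∨ ⋀[ Q ] b
  ⋀[]-× {P} {Q} {b} = ≤-antisym
    (begin
      ⋀[ P × Q ] b            ≤⟨ ⋀-glb (λ q → ⋀-glb (λ p → ≤-trans (⋀-lb (p , q)) (x≤x∨y b b))) ⟩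
      ⋀[ Q ] (⋀[ P ] (b ∨ b)) ≡⟨ cong ⋀[ Q ]_ (dualFrameDistributive b _) ⟨
      ⋀[ Q ] (b ∨ ⋀[ P ] b)   ≡⟨ cong ⋀[ Q ]_ (∨-comm b _) ⟩
      ⋀[ Q ] (⋀[ P ] b ∨ b)   ≡⟨ dualFrameDistributive (⋀[ P ] b) _ ⟨
      ⋀[ P ] b ∨ ⋀[ Q ] b     ∎)
    (∨-least (⋀[]-antitone proj₁) (⋀[]-antitone proj₂))

record SequentCalculus : Set₁ where
  infix 4 _⊢_
  infixr 7 _∧ᶠ_
  infixr 6 _∨ᶠ_
  field
    Fm : Set
    _⊢_ : Fm → Fm → Set
    ⊤ᶠ ⊥ᶠ : Fm
    _∧ᶠ_ _∨ᶠ_ : Fm → Fm → Fm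
    ⊢-refl : ∀ {φ} → φ ⊢ φ
    ⊢-cut : ∀ {φ ψ χ} → φ ⊢ ψ → ψ ⊢ χ → φ ⊢ χ
    ⊥ᶠ-l : ∀ {φ} → ⊥ᶠ ⊢ φ
    ⊤ᶠ-r : ∀ {φ} → φ ⊢ ⊤ᶠ
    ∧ᶠ-l₁ : ∀ {φ ψ} → φ ∧ᶠ ψ ⊢ φ
    ∧ᶠ-l₂ : ∀ {φ ψ} → φ ∧ᶠ ψ ⊢ ψ
    ∧ᶠ-r : ∀ {φ ψ χ} → φ ⊢ ψ → φ ⊢ χ → φ ⊢ ψ ∧ᶠ χ
    ∨ᶠ-r₁ : ∀ {φ ψ} → φ ⊢ φ ∨ᶠ ψ
    ∨ᶠ-r₂ : ∀ {φ ψ} → ψ ⊢ φ ∨ᶠ ψ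
    ∨ᶠ-l : ∀ {φ ψ χ} → φ ⊢ χ → ψ ⊢ χ → φ ∨ᶠ ψ ⊢ χ
    ⊤ᶠ-consistent : ¬ (⊤ᶠ ⊢ ⊥ᶠ)
    inconsistent? : (φ : Fm) → Dec (φ ⊢ ⊥ᶠ)

  Consistent : Fm → Set
  Consistent φ = ¬ (φ ⊢ ⊥ᶠ)

  ∨ᶠ-dropˡ : ∀ {φ ψ} → φ ⊢ ⊥ᶠ → φ ∨ᶠ ψ ⊢ ψ
  ∨ᶠ-dropˡ d = ∨ᶠ-l (⊢-cut d ⊥ᶠ-l) ⊢-refl

  ∨ᶠ-dropʳ : ∀ {φ ψ} → ψ ⊢ ⊥ᶠ → φ ∨ᶠ ψ ⊢ φ
  ∨ᶠ-dropʳ d = ∨ᶠ-l ⊢-refl (⊢-cut d ⊥ᶠ-l)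

module CanonicalPoints (A : CRL) (L : SequentCalculus) where
  open CRL A
  open ResiduatedLattice A
  open SequentCalculus L

  WellDefined : (Fm → Carrier) → Set
  WellDefined h = ∀ {φ ψ} → φ ⊢ ψ → ψ ⊢ φ → h φ ≡ h ψ

  record IsPoint (F U : Fm → Carrier) : Set where
    field
      F-wd : WellDefined F
      F-⊤ : F ⊤ᶠ ≡ 𝟙
      F-⊥ : F ⊥ᶠ ≡ 𝟘
      F-∧ : ∀ φ ψ → F (φ ∧ᶠ ψ) ≡ F φ ∧ F ψ
      U-wd : WellDefined U
      U-⊥ : U ⊥ᶠ ≡ 𝟘
      U-⊤ : U ⊤ᶠ ≡ 𝟙
      U-∨ : ∀ φ ψ → U (φ ∨ᶠ ψ) ≡ U φ ∨ U ψ
      compat : ⋀ (λ π → F π ⇒ U π) ≡ 𝟙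

    F≤U : ∀ π → F π ≤ U π
    F≤U π = 𝟙≤⇒ (≤-trans (≤-reflexive (sym compat)) (⋀-lb π))

    F-mono : ∀ {φ ψ} → φ ⊢ ψ → F φ ≤ F ψ
    F-mono {φ} {ψ} d = begin
      F φ          ≡⟨ F-wd (∧ᶠ-r ⊢-refl d) ∧ᶠ-l₁ ⟩
      F (φ ∧ᶠ ψ)   ≡⟨ F-∧ φ ψ ⟩
      F φ ∧ F ψ    ≤⟨ x∧y≤y _ _ ⟩
      F ψ ∎

    U-mono : ∀ {φ ψ} → φ ⊢ ψ → U φ ≤ U ψ
    U-mono {φ} {ψ} d = begin
      U φ          ≤⟨ x≤x∨y _ _ ⟩
      U φ ∨ U ψ    ≡⟨ U-∨ φ ψ ⟨
      U (φ ∨ᶠ ψ)   ≡⟨ U-wd (∨ᶠ-l d ⊢-refl) ∨ᶠ-r₂ ⟩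
      U ψ ∎

    U-inconsistent : ∀ {φ} → φ ⊢ ⊥ᶠ → U φ ≡ 𝟘
    U-inconsistent d = ≤-antisym (≤-trans (U-mono d) (≤-reflexive U-⊥)) 𝟘-min

  consistentPart : (Fm → Carrier) → Fm → Carrier
  consistentPart h π with inconsistent? π
  ... | yes _ = 𝟘
  ... | no _ = h π

  consistentPart-≤ : ∀ h π → consistentPart h π ≤ h π
  consistentPart-≤ h π with inconsistent? π
  ... | yes _ = 𝟘-min
  ... | no _ = ≤-refl

  ≤-consistentPart : ∀ {a} h π → (π ⊢ ⊥ᶠ → a ≤ 𝟘) → (Consistent π → a ≤ h π) →
                     a ≤ consistentPart h π
  ≤-consistentPart h π inc con with inconsistent? π
  ... | yes d = inc d
  ... | no c = con c

  consistentPart-on : ∀ h {π} → Consistent π → consistentPart h π ≡ h π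
  consistentPart-on h {π} c with inconsistent? π
  ... | yes d = ⊥-elim (c d)
  ... | no _ = refl

  consistentPart-off : ∀ h {π} → π ⊢ ⊥ᶠ → consistentPart h π ≡ 𝟘
  consistentPart-off h {π} d with inconsistent? π
  ... | yes _ = refl
  ... | no c = ⊥-elim (c d)

  consistentPart-wd : ∀ {h} → WellDefined h → WellDefined (consistentPart h)
  consistentPart-wd {h} h-wd {φ} {ψ} d e with inconsistent? φ
  ... | yes φ⊥ = sym (consistentPart-off h (⊢-cut e φ⊥))
  ... | no φ-con = trans (h-wd d e) (sym (consistentPart-on h (λ ψ⊥ → φ-con (⊢-cut d ψ⊥))))

  consistentPart-⊤ : ∀ {h} → h ⊤ᶠ ≡ 𝟙 → consistentPart h ⊤ᶠ ≡ 𝟙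
  consistentPart-⊤ {h} h-⊤ = trans (consistentPart-on h ⊤ᶠ-consistent) h-⊤

  consistentPart-∨ : ∀ {h} → WellDefined h → (∀ φ ψ → h (φ ∨ᶠ ψ) ≡ h φ ∨ h ψ) →
                     ∀ φ ψ → consistentPart h (φ ∨ᶠ ψ) ≡ consistentPart h φ ∨ consistentPart h ψ
  consistentPart-∨ {h} h-wd h-∨ φ ψ with inconsistent? φ | inconsistent? ψ
  ... | yes φ⊥ | yes ψ⊥ = begin-equality
    consistentPart h (φ ∨ᶠ ψ) ≡⟨ consistentPart-off h (∨ᶠ-l φ⊥ ψ⊥) ⟩
    𝟘                          ≡⟨ 𝟘-identityˡ 𝟘 ⟨
    𝟘 ∨ 𝟘 ∎
  ... | yes φ⊥ | no ψ-con = begin-equality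
    consistentPart h (φ ∨ᶠ ψ) ≡⟨ consistentPart-on h (λ d → ψ-con (⊢-cut ∨ᶠ-r₂ d)) ⟩
    h (φ ∨ᶠ ψ)                 ≡⟨ h-wd (∨ᶠ-dropˡ φ⊥) ∨ᶠ-r₂ ⟩
    h ψ                        ≡⟨ 𝟘-identityˡ (h ψ) ⟨
    𝟘 ∨ h ψ ∎
  ... | no φ-con | yes ψ⊥ = begin-equality
    consistentPart h (φ ∨ᶠ ψ) ≡⟨ consistentPart-on h (λ d → φ-con (⊢-cut ∨ᶠ-r₁ d)) ⟩
    h (φ ∨ᶠ ψ)                 ≡⟨ h-wd (∨ᶠ-dropʳ ψ⊥) ∨ᶠ-r₁ ⟩
    h φ                        ≡⟨ 𝟘-identityʳ (h φ) ⟨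
    h φ ∨ 𝟘 ∎
  ... | no φ-con | no _ = begin-equality
    consistentPart h (φ ∨ᶠ ψ) ≡⟨ consistentPart-on h (λ d → φ-con (⊢-cut ∨ᶠ-r₁ d)) ⟩
    h (φ ∨ᶠ ψ)                 ≡⟨ h-∨ φ ψ ⟩
    h φ ∨ h ψ ∎

  principalF : Fm → Fm → Carrier
  principalF χ π = ‖ χ ⊢ π ‖

  consistency : Fm → Carrier
  consistency = consistentPart (λ _ → 𝟙)

  principal-isPoint : ∀ {χ} → Consistent χ → IsPoint (principalF χ) consistency
  principal-isPoint {χ} χ-con = record
    { F-wd = λ d e → ‖‖-cong (λ p → ⊢-cut p d) (λ p → ⊢-cut p e)
    ; F-⊤ = ≤-antisym 𝟙-max (‖‖-intro ⊤ᶠ-r)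
    ; F-⊥ = ‖‖-empty χ-con
    ; F-∧ = λ φ ψ → trans (‖‖-cong (λ p → ⊢-cut p ∧ᶠ-l₁ , ⊢-cut p ∧ᶠ-l₂)
                                    (λ (p , q) → ∧ᶠ-r p q)) ‖‖-×
    ; U-wd = consistentPart-wd (λ _ _ → refl)
    ; U-⊥ = consistentPart-off _ ⊢-refl
    ; U-⊤ = consistentPart-⊤ refl
    ; U-∨ = consistentPart-∨ (λ _ _ → refl) (λ _ _ → sym (∨-idem 𝟙))
    ; compat = ⋀⇒-≡𝟙 (λ π → ≤-consistentPart _ π
        (λ π⊥ → ≤-reflexive (‖‖-empty (λ p → χ-con (⊢-cut p π⊥))))
        (λ _ → 𝟙-max))
    }

  -- Given a point (F, U) and a formula χ, replace U by the complement of the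
  -- ideal generated by χ, weighted by F χ: the formulas below χ get F χ.
  coideal : (Fm → Carrier) → Fm → Fm → Carrier
  coideal F χ = consistentPart (λ π → ⋀[ π ⊢ χ ] F χ)

  coideal-isPoint : ∀ {F U} → IsPoint F U → ∀ χ → IsPoint F (coideal F χ)
  coideal-isPoint {F} p χ = record
    { F-wd = F-wd ; F-⊤ = F-⊤ ; F-⊥ = F-⊥ ; F-∧ = F-∧
    ; U-wd = consistentPart-wd below-wd
    ; U-⊥ = consistentPart-off _ ⊢-refl
    ; U-⊤ = consistentPart-⊤ (≤-antisym 𝟙-max
        (⋀-glb (λ ⊤⊢χ → ≤-trans (≤-reflexive (sym F-⊤)) (F-mono ⊤⊢χ))))
    ; U-∨ = consistentPart-∨ below-wd (λ φ ψ →
        trans (⋀[]-cong (λ d → ⊢-cut ∨ᶠ-r₁ d , ⊢-cut ∨ᶠ-r₂ d) (λ (d , e) → ∨ᶠ-l d e)) ⋀[]-×)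
    ; compat = ⋀⇒-≡𝟙 (λ π → ≤-consistentPart _ π
        (λ π⊥ → ≤-trans (F-mono π⊥) (≤-reflexive F-⊥))
        (λ _ → ⋀-glb F-mono))
    }
    where
    open IsPoint p
    below-wd : WellDefined (λ π → ⋀[ π ⊢ χ ] F χ)
    below-wd d e = ⋀[]-cong (⊢-cut e) (⊢-cut d)

  coideal-≤ : ∀ F χ → coideal F χ χ ≤ F χ
  coideal-≤ F χ = ≤-trans (consistentPart-≤ _ χ) (⋀-lb ⊢-refl)

record PointSpace (A : CRL) (L : SequentCalculus) : Set₁ where
  open CRL A using (Carrier; _⇒_)
  open SequentCalculus L using (Fm)
  open CanonicalPoints A L using (IsPoint)
  field
    Point : Set
    f u : Point → Fm → Carrier
    isPoint : ∀ z → IsPoint (f z) (u z)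
    point : ∀ F U → IsPoint F U → Point
    f-point : ∀ {F U} (p : IsPoint F U) π → f (point F U p) π ≡ F π
    u-point : ∀ {F U} (p : IsPoint F U) π → u (point F U p) π ≡ U π

  Truth : Fm → (Point → Carrier) → (Carrier → Point → Carrier) → Set
  Truth χ ext desc = (∀ z → ext z ≡ f z χ) × (∀ α z → desc α z ≡ (u z χ ⇒ α))

module LowerTruth (A : CRL) (L : SequentCalculus) (S : PointSpace A L) where
  open CRL A
  open ResiduatedLattice A
  open CanonicalPoints A L
  open PointSpace S

  E : Point → Point → Carrier
  E z z' = ⋀ (λ π → f z π ⇒ u z' π)

  lower : (Carrier → Point → Carrier) → Point → Carrier
  lower k z = ⋀ (λ (p : Carrier × Point) → k (proj₁ p) (proj₂ p) ⇒ (E z (proj₂ p) ⇒ proj₁ p))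

  -- '≤' instantiates the meet at α = f z χ and the coideal point of z and χ
  lower-truth : ∀ χ k → (∀ α z' → k α z' ≡ (u z' χ ⇒ α)) → ∀ z → lower k z ≡ f z χ
  lower-truth χ k k≡ z = ≤-antisym
    (begin
      lower k z                            ≤⟨ ⋀-lb (f z χ , w) ⟩
      k (f z χ) w ⇒ (E z w ⇒ f z χ)        ≡⟨ cong (_⇒ (E z w ⇒ f z χ)) (k≡ (f z χ) w) ⟩
      (u w χ ⇒ f z χ) ⇒ (E z w ⇒ f z χ)    ≤⟨ ⇒-discharge (≤⇒𝟙 uwχ≤fzχ) ⟩
      E z w ⇒ f z χ                         ≤⟨ ⇒-discharge 𝟙≤Ezw ⟩
      f z χ ∎)
    (⋀-glb (λ (α , z') → ≤-trans (⇒-exchange (⇒-chain (⋀-lb χ)))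
                                  (≤-reflexive (cong (_⇒ (E z z' ⇒ α)) (sym (k≡ α z'))))))
    where
    w-isPoint : IsPoint (f z) (coideal (f z) χ)
    w-isPoint = coideal-isPoint (isPoint z) χ
    w : Point
    w = point _ _ w-isPoint
    uwχ≤fzχ : u w χ ≤ f z χ
    uwχ≤fzχ = ≤-trans (≤-reflexive (u-point w-isPoint χ)) (coideal-≤ (f z) χ)
    𝟙≤Ezw : 𝟙 ≤ E z w
    𝟙≤Ezw = 𝟙≤⋀⇒ (λ π → ≤-trans (IsPoint.F≤U w-isPoint π) (≤-reflexive (sym (u-point w-isPoint π))))

  truth-from-description : ∀ {χ desc} → (∀ α z → desc α z ≡ (u z χ ⇒ α)) → Truth χ (lower desc) desc
  truth-from-description {χ} {desc} desc≡ = lower-truth χ desc desc≡ , desc≡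

record Modality (L M : SequentCalculus) : Set where
  open SequentCalculus
  field
    apply : Fm L → Fm M
    mono : ∀ {σ τ} → _⊢_ L σ τ → _⊢_ M (apply σ) (apply τ)
    normal : _⊢_ M (apply (⊥ᶠ L)) (⊥ᶠ M)

-- The description of a modal formula m σ over a relation between points of
-- X (over M) and points of Y (over L) built from m; (·)^[1] is the case of the
-- identity modality, with the relation E read backwards.
module DescriptionTruth (A : CRL) {L M : SequentCalculus}
                        (X : PointSpace A M) (Y : PointSpace A L) (m : Modality L M) where
  open CRL A
  open ResiduatedLattice A
  open SequentCalculus L
  open CanonicalPoints A L using (IsPoint; principalF; consistency; principal-isPoint)
  open Modality m
  module X = PointSpace X
  module Y = PointSpace Y

  R : X.Point → Y.Point → Carrier
  R x y = ⋀ (λ τ → Y.f y τ ⇒ X.u x (apply τ))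

  description : (Y.Point → Carrier) → Carrier → X.Point → Carrier
  description ext α x = ⋀ (λ y → ext y ⇒ (R x y ⇒ α))

  -- '≤' instantiates the meet at the principal point of σ when σ is
  -- consistent; when σ is inconsistent, u x (m σ) = 𝟘 and the bound is 𝟙
  description-truth : ∀ σ ext → (∀ y → ext y ≡ Y.f y σ) →
                      ∀ α x → description ext α x ≡ (X.u x (apply σ) ⇒ α)
  description-truth σ ext ext≡ α x = ≤-antisym description≤
    (⋀-glb (λ y → ≤-trans (⇒-chain (⋀-lb σ)) (≤-reflexive (cong (_⇒ (R x y ⇒ α)) (sym (ext≡ y))))))
    where
    open CanonicalPoints.IsPoint (X.isPoint x) using (U-mono; U-inconsistent)
    description≤ : description ext α x ≤ X.u x (apply σ) ⇒ α
    description≤ with inconsistent? σ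
    ... | yes σ⊥ = ≤-trans 𝟙-max (≤-reflexive (sym (trans
          (cong (_⇒ α) (U-inconsistent (SequentCalculus.⊢-cut M (mono σ⊥) normal))) 𝟘⇒)))
    ... | no σ-con = begin
      description ext α x          ≤⟨ ⋀-lb y ⟩
      ext y ⇒ (R x y ⇒ α)          ≡⟨ cong (_⇒ (R x y ⇒ α)) (trans (ext≡ y) (Y.f-point y-isPoint σ)) ⟩
      principalF σ σ ⇒ (R x y ⇒ α) ≤⟨ ⇒-discharge (‖‖-intro ⊢-refl) ⟩
      R x y ⇒ α                    ≤⟨ ⇒-antitone (⋀-glb uxσ≤) ⟩
      X.u x (apply σ) ⇒ α ∎
      where
      y-isPoint : IsPoint (principalF σ) consistency
      y-isPoint = principal-isPoint σ-con
      y : Y.Point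
      y = Y.point _ _ y-isPoint
      uxσ≤ : ∀ τ → X.u x (apply σ) ≤ Y.f y τ ⇒ X.u x (apply τ)
      uxσ≤ τ = ⇒-exchange (≤-trans (≤-reflexive (Y.f-point y-isPoint τ))
                 (‖‖-elim (λ σ⊢τ → ≤⇒𝟙 (U-mono (mono σ⊢τ)))))

  modal-truth : ∀ σ {ext} → (∀ y → ext y ≡ Y.f y σ) →
                X.Truth (apply σ) (LowerTruth.lower A M X (description ext)) (description ext)
  modal-truth σ ext≡ = LowerTruth.truth-from-description A M X (description-truth σ _ ext≡)

identityModality : ∀ {L} → Modality L L
identityModality {L} = record { apply = λ φ → φ ; mono = λ d → d ; normal = SequentCalculus.⊢-refl L }

module ConnectiveTruth (A : CRL) (L : SequentCalculus) (S : PointSpace A L) where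
  open CRL A
  open ResiduatedLattice A
  open SequentCalculus L
  open CanonicalPoints A L using (module IsPoint)
  open PointSpace S
  open LowerTruth A L S
  open DescriptionTruth A S S identityModality
    renaming (description to upper; description-truth to upper-truth)

  truth-from-extension : ∀ {χ ext} → (∀ z → ext z ≡ f z χ) → Truth χ ext (upper ext)
  truth-from-extension {χ} {ext} ext≡ = ext≡ , upper-truth χ ext ext≡

  truth-⊤ : Truth ⊤ᶠ (λ _ → 𝟙) (upper (λ _ → 𝟙))
  truth-⊤ = truth-from-extension (λ z → sym (IsPoint.F-⊤ (isPoint z)))

  truth-⊥ : Truth ⊥ᶠ (lower (λ _ _ → 𝟙)) (λ _ _ → 𝟙)
  truth-⊥ = truth-from-description (λ α z → sym (trans (cong (_⇒ α) (IsPoint.U-⊥ (isPoint z))) 𝟘⇒))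

  truth-∧ : ∀ {φ ψ e₁ e₂ d₁ d₂} → Truth φ e₁ d₁ → Truth ψ e₂ d₂ →
            Truth (φ ∧ᶠ ψ) (λ z → e₁ z ∧ e₂ z) (upper (λ z → e₁ z ∧ e₂ z))
  truth-∧ {φ} {ψ} (e₁≡ , _) (e₂≡ , _) = truth-from-extension (λ z →
    trans (cong₂ _∧_ (e₁≡ z) (e₂≡ z)) (sym (IsPoint.F-∧ (isPoint z) φ ψ)))

  truth-∨ : ∀ {φ ψ e₁ e₂ d₁ d₂} → Truth φ e₁ d₁ → Truth ψ e₂ d₂ →
            Truth (φ ∨ᶠ ψ) (lower (λ α z → d₁ α z ∧ d₂ α z)) (λ α z → d₁ α z ∧ d₂ α z)
  truth-∨ {φ} {ψ} {d₁ = d₁} {d₂ = d₂} (_ , d₁≡) (_ , d₂≡) = truth-from-description (λ α z → begin-equality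
    d₁ α z ∧ d₂ α z               ≡⟨ cong₂ _∧_ (d₁≡ α z) (d₂≡ α z) ⟩
    (u z φ ⇒ α) ∧ (u z ψ ⇒ α)     ≡⟨ ⇒-∨ (u z φ) (u z ψ) α ⟩
    (u z φ ∨ u z ψ) ⇒ α           ≡⟨ cong (_⇒ α) (IsPoint.U-∨ (isPoint z) φ ψ) ⟨
    u z (φ ∨ᶠ ψ) ⇒ α ∎)

module MultiTypeCalculi (AtP AtS : Set) where
  open Syntax AtP AtS

  mutual
    holdsP : PP → Bool
    holdsP (atP _) = true
    holdsP ⊤P = true
    holdsP ⊥P = false
    holdsP (φ ∧P ψ) = holdsP φ ∧ᵇ holdsP ψ
    holdsP (φ ∨P ψ) = holdsP φ ∨ᵇ holdsP ψ
    holdsP (loz σ) = holdsS σ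

    holdsS : SD → Bool
    holdsS (atS _) = true
    holdsS ⊤S = true
    holdsS ⊥S = false
    holdsS (φ ∧S ψ) = holdsS φ ∧ᵇ holdsS ψ
    holdsS (φ ∨S ψ) = holdsS φ ∨ᵇ holdsS ψ
    holdsS (dia π) = holdsP π

  mutual
    soundP : ∀ {φ ψ} → φ ⊢P ψ → T (holdsP φ) → T (holdsP ψ)
    soundP idP t = t
    soundP (cutP d e) t = soundP e (soundP d t)
    soundP ⊥P-l ()
    soundP ⊤P-r _ = _
    soundP ∧P-l₁ t = proj₁ (Equivalence.to T-∧ t)
    soundP ∧P-l₂ t = proj₂ (Equivalence.to T-∧ t)
    soundP (∧P-r d e) t = Equivalence.from T-∧ (soundP d t , soundP e t)
    soundP ∨P-r₁ t = Equivalence.from T-∨ (inj₁ t)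
    soundP ∨P-r₂ t = Equivalence.from T-∨ (inj₂ t)
    soundP (∨P-l d e) t = [ soundP d , soundP e ] (Equivalence.to T-∨ t)
    soundP (loz-mono d) t = soundS d t
    soundP loz-⊥ ()
    soundP loz-∨ t = t

    soundS : ∀ {φ ψ} → φ ⊢S ψ → T (holdsS φ) → T (holdsS ψ)
    soundS idS t = t
    soundS (cutS d e) t = soundS e (soundS d t)
    soundS ⊥S-l ()
    soundS ⊤S-r _ = _
    soundS ∧S-l₁ t = proj₁ (Equivalence.to T-∧ t)
    soundS ∧S-l₂ t = proj₂ (Equivalence.to T-∧ t)
    soundS (∧S-r d e) t = Equivalence.from T-∧ (soundS d t , soundS e t)
    soundS ∨S-r₁ t = Equivalence.from T-∨ (inj₁ t)
    soundS ∨S-r₂ t = Equivalence.from T-∨ (inj₂ t)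
    soundS (∨S-l d e) t = [ soundS d , soundS e ] (Equivalence.to T-∨ t)
    soundS (dia-mono d) t = soundP d t
    soundS dia-⊥ ()
    soundS dia-∨ t = t

  mutual
    refuteP : ∀ φ → ¬ T (holdsP φ) → φ ⊢P ⊥P
    refuteP (atP _) ¬t = ⊥-elim (¬t _)
    refuteP ⊤P ¬t = ⊥-elim (¬t _)
    refuteP ⊥P _ = idP
    refuteP (φ ∧P ψ) ¬t with T? (holdsP φ)
    ... | yes t = cutP ∧P-l₂ (refuteP ψ (λ t' → ¬t (Equivalence.from T-∧ (t , t'))))
    ... | no ¬tφ = cutP ∧P-l₁ (refuteP φ ¬tφ)
    refuteP (φ ∨P ψ) ¬t = ∨P-l (refuteP φ (λ t → ¬t (Equivalence.from T-∨ (inj₁ t))))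
                               (refuteP ψ (λ t → ¬t (Equivalence.from T-∨ (inj₂ t))))
    refuteP (loz σ) ¬t = cutP (loz-mono (refuteS σ ¬t)) loz-⊥

    refuteS : ∀ φ → ¬ T (holdsS φ) → φ ⊢S ⊥S
    refuteS (atS _) ¬t = ⊥-elim (¬t _)
    refuteS ⊤S ¬t = ⊥-elim (¬t _)
    refuteS ⊥S _ = idS
    refuteS (φ ∧S ψ) ¬t with T? (holdsS φ)
    ... | yes t = cutS ∧S-l₂ (refuteS ψ (λ t' → ¬t (Equivalence.from T-∧ (t , t'))))
    ... | no ¬tφ = cutS ∧S-l₁ (refuteS φ ¬tφ)
    refuteS (φ ∨S ψ) ¬t = ∨S-l (refuteS φ (λ t → ¬t (Equivalence.from T-∨ (inj₁ t))))
                               (refuteS ψ (λ t → ¬t (Equivalence.from T-∨ (inj₂ t))))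
    refuteS (dia π) ¬t = cutS (dia-mono (refuteP π ¬t)) dia-⊥

  inconsistentP? : ∀ φ → Dec (φ ⊢P ⊥P)
  inconsistentP? φ with T? (holdsP φ)
  ... | yes t = no (λ d → soundP d t)
  ... | no ¬t = yes (refuteP φ ¬t)

  inconsistentS? : ∀ φ → Dec (φ ⊢S ⊥S)
  inconsistentS? φ with T? (holdsS φ)
  ... | yes t = no (λ d → soundS d t)
  ... | no ¬t = yes (refuteS φ ¬t)

  PP-calculus : SequentCalculus
  PP-calculus = record
    { Fm = PP ; _⊢_ = _⊢P_ ; ⊤ᶠ = ⊤P ; ⊥ᶠ = ⊥P ; _∧ᶠ_ = _∧P_ ; _∨ᶠ_ = _∨P_
    ; ⊢-refl = idP ; ⊢-cut = cutP ; ⊥ᶠ-l = ⊥P-l ; ⊤ᶠ-r = ⊤P-r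
    ; ∧ᶠ-l₁ = ∧P-l₁ ; ∧ᶠ-l₂ = ∧P-l₂ ; ∧ᶠ-r = ∧P-r
    ; ∨ᶠ-r₁ = ∨P-r₁ ; ∨ᶠ-r₂ = ∨P-r₂ ; ∨ᶠ-l = ∨P-l
    ; ⊤ᶠ-consistent = λ d → soundP d _
    ; inconsistent? = inconsistentP?
    }

  SD-calculus : SequentCalculus
  SD-calculus = record
    { Fm = SD ; _⊢_ = _⊢S_ ; ⊤ᶠ = ⊤S ; ⊥ᶠ = ⊥S ; _∧ᶠ_ = _∧S_ ; _∨ᶠ_ = _∨S_
    ; ⊢-refl = idS ; ⊢-cut = cutS ; ⊥ᶠ-l = ⊥S-l ; ⊤ᶠ-r = ⊤S-r
    ; ∧ᶠ-l₁ = ∧S-l₁ ; ∧ᶠ-l₂ = ∧S-l₂ ; ∧ᶠ-r = ∧S-r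
    ; ∨ᶠ-r₁ = ∨S-r₁ ; ∨ᶠ-r₂ = ∨S-r₂ ; ∨ᶠ-l = ∨S-l
    ; ⊤ᶠ-consistent = λ d → soundS d _
    ; inconsistent? = inconsistentS?
    }

  ◊-modality : Modality SD-calculus PP-calculus
  ◊-modality = record { apply = loz ; mono = loz-mono ; normal = loz-⊥ }

  ◇-modality : Modality PP-calculus SD-calculus
  ◇-modality = record { apply = dia ; mono = dia-mono ; normal = dia-⊥ }

module CanonicalSpaces (A : CRL) (AtP AtS : Set) where
  open MultiTypeCalculi AtP AtS
  open Canonical A AtP AtS
  open CanonicalPoints A PP-calculus using () renaming (module IsPoint to IsPointP)
  open CanonicalPoints A SD-calculus using () renaming (module IsPoint to IsPointS)

  ZS-space : PointSpace A PP-calculus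
  ZS-space = record
    { Point = ZS ; f = ZS.f ; u = ZS.u
    ; isPoint = λ z → let open ZS z in record
        { F-wd = f-wd ; F-⊤ = f-⊤ ; F-⊥ = f-⊥ ; F-∧ = f-∧
        ; U-wd = u-wd ; U-⊥ = u-⊥ ; U-⊤ = u-⊤ ; U-∨ = u-∨ ; compat = fu-compat }
    ; point = λ F U p → let open IsPointP p in record
        { f = F ; u = U
        ; f-wd = F-wd ; f-⊤ = F-⊤ ; f-⊥ = F-⊥ ; f-∧ = F-∧
        ; u-wd = U-wd ; u-⊥ = U-⊥ ; u-⊤ = U-⊤ ; u-∨ = U-∨ ; fu-compat = compat }
    ; f-point = λ _ _ → refl ; u-point = λ _ _ → refl
    }

  ZP-space : PointSpace A SD-calculus
  ZP-space = record
    { Point = ZP ; f = ZP.g ; u = ZP.v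
    ; isPoint = λ z → let open ZP z in record
        { F-wd = g-wd ; F-⊤ = g-⊤ ; F-⊥ = g-⊥ ; F-∧ = g-∧
        ; U-wd = v-wd ; U-⊥ = v-⊥ ; U-⊤ = v-⊤ ; U-∨ = v-∨ ; compat = gv-compat }
    ; point = λ F U p → let open IsPointS p in record
        { g = F ; v = U
        ; g-wd = F-wd ; g-⊤ = F-⊤ ; g-⊥ = F-⊥ ; g-∧ = F-∧
        ; v-wd = U-wd ; v-⊥ = U-⊥ ; v-⊤ = U-⊤ ; v-∨ = U-∨ ; gv-compat = compat }
    ; f-point = λ _ _ → refl ; u-point = λ _ _ → refl
    }

module TruthLemma (A : CRL) (AtP AtS : Set) where
  open Syntax AtP AtS
  open Canonical A AtP AtS
  open MultiTypeCalculi AtP AtS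
  open CanonicalSpaces A AtP AtS
  module P = ConnectiveTruth A PP-calculus ZS-space
  module S = ConnectiveTruth A SD-calculus ZP-space
  open DescriptionTruth A ZS-space ZP-space ◊-modality using () renaming (modal-truth to ◊-truth)
  open DescriptionTruth A ZP-space ZS-space ◇-modality using () renaming (modal-truth to ◇-truth)
  open PointSpace ZS-space using () renaming (Truth to TruthP)
  open PointSpace ZP-space using () renaming (Truth to TruthS)

  mutual
    truthP : (π : PP) → TruthP π ⟦ π ⟧P ⦅ π ⦆P
    truthP (atP _) = (λ _ → refl) , (λ _ _ → refl)
    truthP ⊤P = P.truth-⊤
    truthP ⊥P = P.truth-⊥
    truthP (φ ∧P ψ) = P.truth-∧ (truthP φ) (truthP ψ)
    truthP (φ ∨P ψ) = P.truth-∨ (truthP φ) (truthP ψ)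
    truthP (loz σ) = ◊-truth σ (proj₁ (truthS σ))

    truthS : (σ : SD) → TruthS σ ⟦ σ ⟧S ⦅ σ ⦆S
    truthS (atS _) = (λ _ → refl) , (λ _ _ → refl)
    truthS ⊤S = S.truth-⊤
    truthS ⊥S = S.truth-⊥
    truthS (φ ∧S ψ) = S.truth-∧ (truthS φ) (truthS ψ)
    truthS (φ ∨S ψ) = S.truth-∨ (truthS φ) (truthS ψ)
    truthS (dia π) = ◇-truth π (proj₁ (truthP π))

mainTheorem8 : (A : CRL) (AtP AtS : Set) →
    let open CRL A
        open Syntax AtP AtS
        open Canonical A AtP AtS
    in ((π : PP) → ((z : ZS) → ⟦ π ⟧P z ≡ ZS.f z π)
                 × ((α : Carrier) (z : ZS) → ⦅ π ⦆P α z ≡ (ZS.u z π ⇒ α)))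
     × ((σ : SD) → ((z : ZP) → ⟦ σ ⟧S z ≡ ZP.g z σ)
                 × ((α : Carrier) (z : ZP) → ⦅ σ ⦆S α z ≡ (ZP.v z σ ⇒ α)))
mainTheorem8 A AtP AtS = TruthLemma.truthP A AtP AtS , TruthLemma.truthS A AtP AtS
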